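{- Let $\Gamma$ be a finite, simple, strongly connected digraph of order $n\geq 4$ with $\dim(\Gamma)=n-2$. Suppose $x_0,x_1,x_2$ are vertices such that $(x_0,x_1),(x_1,x_2),(x_2,x_0)$ are arcs and $\partial(x_0,x_2)=2$. Let $X_2=\{x\in V(\Gamma)\mid\partial(x_0,x)=2\}$. If $|X_2|\geq 2$, then $\Gamma$ is isomorphic to $G_1[K_1,K_t,K_{n-t-1}]$ or to $G_2[K_1,K_t,K_{n-t-1}]$ for some $1\leq t\leq n-3$.
   Context: $\partial(x,y)$ is the length of a shortest directed path from $x$ to $y$; $\tilde\partial(x,y)=(\partial(x,y),\partial(y,x))$. A vertex set $\{w_1,\dots,w_m\}$ is weakly resolving if $(\tilde\partial(w_1,u),\dots,\tilde\partial(w_m,u))\neq(\tilde\partial(w_1,v),\dots,\tilde\partial(w_m,v))$ for all distinct $u,v$; $\dim(\Gamma)$ is the minimum size of such a set. $K_t$ is the complete digraph on $t$ vertices. $G_1$ is the digraph on $\{0,1,2\}$ with arcs $(0,1),(1,2),(2,1),(2,0)$; $G_2$ is the digraph on $\{0,1,2\}$ with arcs $(0,1),(1,0),(1,2),(2,1),(2,0)$. For a digraph $G$ on $\{0,\dots,m-1\}$ and vertex-disjoint digraphs $H_0,\dots,H_{m-1}$, $G[H_0,\dots,H_{m-1}]$ has vertex set $\bigcup V(H_i)$, and for $x\in V(H_i)$, $y\in V(H_j)$, $(x,y)$ is an arc iff either $i=j$ and $(x,y)$ is an arc of $H_i$, or $i\neq j$ and $(i,j)$ is an arc of $G$. -}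

module Defs where

open import Data.Nat using (ℕ; zero; suc; _<_; _≤_)
open import Data.Fin using (Fin; zero; suc; _≟_)
open import Data.Fin.Subset using (Subset; _∈_; ∣_∣)
open import Data.Bool using (Bool; true; false; T)
open import Data.Product using (Σ; ∃; ∃-syntax; _×_; _,_; proj₁; proj₂)
open import Data.Sum using (_⊎_)
open import Data.Vec using (Vec; []; _∷_; lookup)
open import Relation.Nullary using (¬_)
open import Relation.Binary.PropositionalEquality using (_≡_; _≢_; subst)
open import Function.Bundles using (_↔_; _⇔_; Inverse)

Digraph : ℕ → Set
Digraph n = Fin n → Fin n → Bool

-- simple: no loops (multiple arcs are impossible by construction)
Simple : ∀ {n} → Digraph n → Set
Simple Γ = ∀ x → Γ x x ≡ false

data Walk {n} (Γ : Digraph n) : Fin n → Fin n → ℕ → Set where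
  nil  : ∀ {x} → Walk Γ x x 0
  cons : ∀ {x y z k} → T (Γ x y) → Walk Γ y z k → Walk Γ x z (suc k)

Dist : ∀ {n} → Digraph n → Fin n → Fin n → ℕ → Set
Dist Γ x y d = Walk Γ x y d × (∀ k → k < d → ¬ Walk Γ x y k)

StronglyConnected : ∀ {n} → Digraph n → Set
StronglyConnected Γ = ∀ x y → ∃[ d ] Walk Γ x y d

Distinguishes : ∀ {n} → Digraph n → Fin n → Fin n → Fin n → Set
Distinguishes Γ w u v =
  ∃[ a ] ∃[ b ] ∃[ c ] ∃[ d ]
    (Dist Γ w u a × Dist Γ u w b × Dist Γ w v c × Dist Γ v w d × (a , b) ≢ (c , d))

WeaklyResolving : ∀ {n} → Digraph n → Subset n → Set
WeaklyResolving Γ W = ∀ u v → u ≢ v → ∃[ w ] (w ∈ W × Distinguishes Γ w u v)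

MetricDim : ∀ {n} → Digraph n → ℕ → Set
MetricDim Γ k =
  (∃[ W ] (WeaklyResolving Γ W × ∣ W ∣ ≡ k)) ×
  (∀ W → WeaklyResolving Γ W → k ≤ ∣ W ∣)

K : (t : ℕ) → Fin t → Fin t → Set
K t x y = x ≢ y

G₁ : Fin 3 → Fin 3 → Set
G₁ zero (suc zero) = Data.Unit.⊤ where import Data.Unit
G₁ (suc zero) (suc (suc zero)) = Data.Unit.⊤ where import Data.Unit
G₁ (suc (suc zero)) (suc zero) = Data.Unit.⊤ where import Data.Unit
G₁ (suc (suc zero)) zero = Data.Unit.⊤ where import Data.Unit
G₁ _ _ = Data.Empty.⊥ where import Data.Empty

G₂ : Fin 3 → Fin 3 → Set
G₂ zero (suc zero) = Data.Unit.⊤ where import Data.Unit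
G₂ (suc zero) zero = Data.Unit.⊤ where import Data.Unit
G₂ (suc zero) (suc (suc zero)) = Data.Unit.⊤ where import Data.Unit
G₂ (suc (suc zero)) (suc zero) = Data.Unit.⊤ where import Data.Unit
G₂ (suc (suc zero)) zero = Data.Unit.⊤ where import Data.Unit
G₂ _ _ = Data.Empty.⊥ where import Data.Empty

Comp : ∀ {m} (G : Fin m → Fin m → Set) (s : Fin m → ℕ)
       (H : ∀ i → Fin (s i) → Fin (s i) → Set) →
       Σ (Fin m) (λ i → Fin (s i)) → Σ (Fin m) (λ i → Fin (s i)) → Set
Comp G s H (i , a) (j , b) =
  (Σ (i ≡ j) λ e → H j (subst (λ k → Fin (s k)) e a) b) ⊎ (i ≢ j × G i j)

sizes : ℕ → ℕ → Fin 3 → ℕ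
sizes n t i = lookup (1 ∷ t ∷ (n Data.Nat.∸ t Data.Nat.∸ 1) ∷ []) i

Comp3K : (G : Fin 3 → Fin 3 → Set) → (n t : ℕ) →
         Σ (Fin 3) (λ i → Fin (sizes n t i)) → Σ (Fin 3) (λ i → Fin (sizes n t i)) → Set
Comp3K G n t = Comp G (sizes n t) (λ i → K (sizes n t i))

Isomorphic : ∀ {n} {V : Set} → Digraph n → (V → V → Set) → Set
Isomorphic {n} {V} Γ B =
  Σ (Fin n ↔ V) λ f → ∀ x y → T (Γ x y) ⇔ B (Inverse.to f x) (Inverse.to f y)

module Submission where

-- Since dim Γ = n − 2, no three vertices p, q, r can have every pair resolved by a vertex outside
-- {p, q, r}: otherwise V ∖ {p, q, r} would be a resolving set of size n − 3. A vertex whose arcs to u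
-- and to v differ resolves u and v, so among any three vertices two are twins with respect to all
-- other vertices, and a shortest walk u → p → q → r would contradict this: Γ has diameter two.
-- Split V into {x₀}, the out-neighbours X₁ of x₀ and the rest X₂. Since x₀ sees X₁ and X₂
-- differently, the twin property (used with x₁, x₂ and two vertices of X₂) forces X₁ and X₂ to be
-- cliques, all arcs between X₁ and X₂ and from X₂ to x₀ to be present, and arcs from X₁ to x₀ to be
-- present for all of X₁ or for none: Γ is G₂ resp. G₁ composed with complete digraphs.

open import Defs
open import Axiom.UniquenessOfIdentityProofs using (module Decidable⇒UIP)
open import Data.Bool using (Bool; true; false; T)
import Data.Bool as Bool
open import Data.Bool.Properties using (T-≡)
open import Data.Empty using (⊥; ⊥-elim)
open import Data.Fin using (Fin; zero; suc; _≟_)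
open import Data.Fin.Patterns using (0F; 1F; 2F)
open import Data.Fin.Permutation using (↔⇒≡)
open import Data.Fin.Properties using (any?; +↔⊎; ∃-here; ∃-there; ∃-toSum)
open import Data.Fin.Subset using (Subset; _∈_; ∣_∣; ⊤; ⁅_⁆; _─_)
open import Data.Fin.Subset.Properties
  using (∈⊤; x∈⁅x⁆; x∈⁅y⁆⇒x≡y; x∈p∩q⁺; x∈p∧x∉q⇒x∈p─q; p∩q≢∅⇒∣p─q∣<∣p∣; ∣⊤∣≡n)
open import Data.Nat using (ℕ; zero; suc; _+_; _∸_; _<_; _≤_; _≡ᵇ_; z≤n; s≤s)
open import Data.Nat.Properties
  using ( +-suc; +-identityʳ; +-monoˡ-<; +-monoʳ-≤; m≤m+n; m<1+n⇒m<n∨m≡n; ≤-antisym; ≤-trans; ≮⇒≥; <⇒≱; n<1+n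
        ; module ≤-Reasoning)
open import Data.Product using (Σ; ∃; ∃-syntax; _×_; _,_; proj₁; proj₂)
open import Data.Product.Function.Dependent.Propositional using () renaming (congˡ to Σ-congˡ)
open import Data.Product.Properties using (Σ-≡,≡→≡)
open import Data.Sum using (_⊎_; inj₁; inj₂; [_,_])
open import Data.Sum.Function.Propositional using (_⊎-cong_)
open import Data.Unit using (tt)
open import Data.Vec using (_∷_; []; lookup)
open import Data.Vec.Functional using (foldr)
open import Function using (_∘_)
open import Function.Bundles using (_↔_; _⇔_; Equivalence; Inverse; Injection; mk↔ₛ′; mk⇔)
open import Function.Properties.Inverse using (↔-refl; ↔-sym; ↔-trans; ↔⇒↣)
open import Relation.Binary.PropositionalEquality hiding ([_])
open import Relation.Nullary using (¬_; Dec; yes; no)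
open import Relation.Nullary.Decidable using (_×-dec_; _⊎-dec_; ¬?; decidable-stable)
open import Relation.Nullary.Irrelevant using (Irrelevant)
open import Relation.Unary using (Decidable)

clash : ∀ {a b : Bool} → a ≡ true → a ≡ b → b ≡ false → ⊥
clash refl refl ()

arc⇒≢ : ∀ {n} {Γ : Digraph n} → Simple Γ → ∀ {x y} → Γ x y ≡ true → x ≢ y
arc⇒≢ simple {x} x→y refl = clash x→y refl (simple x)

-- Shortest walks and distances

least-witness : {P : ℕ → Set} → Decidable P → ∀ {d} → P d → ∃[ k ] (P k × ∀ j → j < k → ¬ P j)
least-witness {P} P? {d} Pd = search 0 (λ _ ()) d (+-identityʳ d)
  where
  search : ∀ m → (∀ j → j < m → ¬ P j) → ∀ r → r + m ≡ d → ∃[ k ] (P k × ∀ j → j < k → ¬ P j)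
  search m below r r+m≡d with P? m
  search m below r       r+m≡d | yes Pm = m , Pm , below
  search m below zero    m≡d   | no ¬Pm = ⊥-elim (¬Pm (subst P (sym m≡d) Pd))
  search m below (suc r) r+m≡d | no ¬Pm = search (suc m) below′ r (trans (+-suc r m) r+m≡d)
    where
    below′ : ∀ j → j < suc m → ¬ P j
    below′ j j<1+m with m<1+n⇒m<n∨m≡n j<1+m
    ... | inj₁ j<m  = below j j<m
    ... | inj₂ refl = ¬Pm

module _ {n : ℕ} (Γ : Digraph n) where

  walk? : ∀ k x y → Dec (Walk Γ x y k)
  walk? zero x y with x ≟ y
  ... | yes refl = yes nil
  ... | no x≢y   = no λ { nil → x≢y refl }
  walk? (suc k) x y with any? (λ z → Bool.T? (Γ x z) ×-dec walk? k z y)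
  ... | yes (z , xz , zy) = yes (cons xz zy)
  ... | no ¬step          = no λ { (cons xz zy) → ¬step (_ , xz , zy) }

  _++ʷ_ : ∀ {x y z i j} → Walk Γ x y i → Walk Γ y z j → Walk Γ x z (i + j)
  nil       ++ʷ q = q
  cons xy p ++ʷ q = cons xy (p ++ʷ q)

  Dist-unique : ∀ {x y a b} → Dist Γ x y a → Dist Γ x y b → a ≡ b
  Dist-unique (pa , shortest-a) (pb , shortest-b) =
    ≤-antisym (≮⇒≥ λ b<a → shortest-a _ b<a pb) (≮⇒≥ λ a<b → shortest-b _ a<b pa)

  Dist-refl : ∀ x → Dist Γ x x 0
  Dist-refl x = nil , λ _ ()

  Dist-0⇒≡ : ∀ {x y} → Dist Γ x y 0 → x ≡ y
  Dist-0⇒≡ (nil , _) = refl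

  Dist-≢ : ∀ {u x y a c} → Dist Γ u x a → Dist Γ u y c → a ≢ c → x ≢ y
  Dist-≢ ux uy a≢c refl = a≢c (Dist-unique ux uy)

  Dist-prefix : ∀ {x y z i j} → Dist Γ x z (i + j) → Walk Γ x y i → Walk Γ y z j → Dist Γ x y i
  Dist-prefix {j = j} (_ , shortest) p q = p , λ k k<i p′ → shortest (k + j) (+-monoˡ-< j k<i) (p′ ++ʷ q)

  dist : StronglyConnected Γ → ∀ x y → ∃ (Dist Γ x y)
  dist sc x y = least-witness (λ k → walk? k x y) (proj₂ (sc x y))

  module _ (sc : StronglyConnected Γ) where

    distinguishes-by-distance : ∀ {w u v a c} → Dist Γ w u a → Dist Γ w v c → a ≢ c → Distinguishes Γ w u v
    distinguishes-by-distance {w} {u} {v} {a} {c} wu wv a≢c with dist sc u w | dist sc v w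
    ... | b , uw | d , vw = a , b , c , d , wu , uw , wv , vw , λ ab≡cd → a≢c (cong proj₁ ab≡cd)

    distinguishes-self : ∀ {u v} → u ≢ v → Distinguishes Γ u u v
    distinguishes-self {u} {v} u≢v with dist sc u v
    ... | c , uv = distinguishes-by-distance (Dist-refl u) uv λ { refl → u≢v (Dist-0⇒≡ uv) }

  module _ (simple : Simple Γ) where

    arc≡[dist≡ᵇ1] : ∀ {x y a} → Dist Γ x y a → Γ x y ≡ (a ≡ᵇ 1)
    arc≡[dist≡ᵇ1] {x} {a = zero}        (nil , _)          = simple x
    arc≡[dist≡ᵇ1] {a = suc zero}        (cons xy nil , _)  = Equivalence.to T-≡ xy
    arc≡[dist≡ᵇ1] {x} {y} {suc (suc a)} (_ , shortest) with Γ x y in xy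
    ... | false = refl
    ... | true  = ⊥-elim (shortest 1 (s≤s (s≤s z≤n)) (cons (Equivalence.from T-≡ xy) nil))

    at-distance-2 : ∀ {x y} → Dist Γ x y 2 → y ≢ x × Γ x y ≡ false
    at-distance-2 {x} xy = ≢-sym (Dist-≢ (Dist-refl x) xy λ ()) , arc≡[dist≡ᵇ1] xy

    distinguishes-by-arcs : StronglyConnected Γ → ∀ {w u v} →
                            Γ w u ≢ Γ w v ⊎ Γ u w ≢ Γ v w → Distinguishes Γ w u v
    distinguishes-by-arcs sc {w} {u} {v} arcs-differ
      with dist sc w u | dist sc u w | dist sc w v | dist sc v w
    ... | a , wu | b , uw | c , wv | d , vw = a , b , c , d , wu , uw , wv , vw , distances-differ
      where
      distances-differ : (a , b) ≢ (c , d)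
      distances-differ refl =
        [ (λ out-differ → out-differ (trans (arc≡[dist≡ᵇ1] wu) (sym (arc≡[dist≡ᵇ1] wv))))
        , (λ in-differ  → in-differ  (trans (arc≡[dist≡ᵇ1] uw) (sym (arc≡[dist≡ᵇ1] vw)))) ] arcs-differ

  Distinguishes-sym : ∀ {w u v} → Distinguishes Γ w u v → Distinguishes Γ w v u
  Distinguishes-sym (a , b , c , d , wu , uw , wv , vw , ab≢cd) =
    c , d , a , b , wv , vw , wu , uw , λ cd≡ab → ab≢cd (sym cd≡ab)

-- Resolving sets in a digraph of metric dimension n − 2

x∈p─⁅y⁆ : ∀ {n} {p : Subset n} {x y} → x ∈ p → x ≢ y → x ∈ p ─ ⁅ y ⁆
x∈p─⁅y⁆ {y = y} x∈p x≢y = x∈p∧x∉q⇒x∈p─q x∈p (x≢y ∘ x∈⁅y⁆⇒x≡y y)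

∣p─⁅x⁆∣<∣p∣ : ∀ {n} {p : Subset n} {x} → x ∈ p → ∣ p ─ ⁅ x ⁆ ∣ < ∣ p ∣
∣p─⁅x⁆∣<∣p∣ {p = p} {x} x∈p = p∩q≢∅⇒∣p─q∣<∣p∣ p ⁅ x ⁆ (x , x∈p∩q⁺ (x∈p , x∈⁅x⁆ x))

n<3+[n∸2] : ∀ n → n < 3 + (n ∸ 2)
n<3+[n∸2] zero          = s≤s z≤n
n<3+[n∸2] (suc zero)    = s≤s (s≤s z≤n)
n<3+[n∸2] (suc (suc n)) = s≤s (s≤s (n<1+n n))

DistinguishedAwayFrom : ∀ {n} → Digraph n → Fin n → Fin n → Fin n → Set
DistinguishedAwayFrom Γ z u v = ∃[ w ] (w ≢ u × w ≢ v × w ≢ z × Distinguishes Γ w u v)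

module _ {n : ℕ} (Γ : Digraph n) (sc : StronglyConnected Γ)
         (dim≥n∸2 : ∀ W → WeaklyResolving Γ W → n ∸ 2 ≤ ∣ W ∣) where

  no-three-pairs-distinguished-away : ∀ {p q r} → p ≢ q → p ≢ r → q ≢ r →
    DistinguishedAwayFrom Γ r p q → DistinguishedAwayFrom Γ q p r → DistinguishedAwayFrom Γ p q r → ⊥
  no-three-pairs-distinguished-away {p} {q} {r} p≢q p≢r q≢r
    (w₁ , w₁≢p , w₁≢q , w₁≢r , pq) (w₂ , w₂≢p , w₂≢r , w₂≢q , pr) (w₃ , w₃≢q , w₃≢r , w₃≢p , qr) =
    <⇒≱ (n<3+[n∸2] n) (≤-trans (+-monoʳ-≤ 3 (dim≥n∸2 W W-resolving)) 3+∣W∣≤n)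
    where
    W : Subset n
    W = ⊤ ─ ⁅ p ⁆ ─ ⁅ q ⁆ ─ ⁅ r ⁆

    ∈W : ∀ {w} → w ≢ p → w ≢ q → w ≢ r → w ∈ W
    ∈W w≢p w≢q w≢r = x∈p─⁅y⁆ (x∈p─⁅y⁆ (x∈p─⁅y⁆ ∈⊤ w≢p) w≢q) w≢r

    3+∣W∣≤n : 3 + ∣ W ∣ ≤ n
    3+∣W∣≤n = begin
      3 + ∣ W ∣                  ≤⟨ s≤s (s≤s (∣p─⁅x⁆∣<∣p∣ (x∈p─⁅y⁆ (x∈p─⁅y⁆ ∈⊤ (≢-sym p≢r)) (≢-sym q≢r)))) ⟩
      2 + ∣ ⊤ ─ ⁅ p ⁆ ─ ⁅ q ⁆ ∣  ≤⟨ s≤s (∣p─⁅x⁆∣<∣p∣ (x∈p─⁅y⁆ ∈⊤ (≢-sym p≢q))) ⟩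
      1 + ∣ ⊤ ─ ⁅ p ⁆ ∣          ≤⟨ ∣p─⁅x⁆∣<∣p∣ (∈⊤ {x = p}) ⟩
      ∣ ⊤ {n} ∣                  ≡⟨ ∣⊤∣≡n n ⟩
      n                          ∎
      where open ≤-Reasoning

    locate : ∀ u → u ≡ p ⊎ u ≡ q ⊎ u ≡ r ⊎ u ∈ W
    locate u with u ≟ p | u ≟ q | u ≟ r
    ... | yes u≡p | _       | _       = inj₁ u≡p
    ... | no _    | yes u≡q | _       = inj₂ (inj₁ u≡q)
    ... | no _    | no _    | yes u≡r = inj₂ (inj₂ (inj₁ u≡r))
    ... | no u≢p  | no u≢q  | no u≢r  = inj₂ (inj₂ (inj₂ (∈W u≢p u≢q u≢r)))

    by-pq : ∃[ w ] (w ∈ W × Distinguishes Γ w p q)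
    by-pq = w₁ , ∈W w₁≢p w₁≢q w₁≢r , pq
    by-pr : ∃[ w ] (w ∈ W × Distinguishes Γ w p r)
    by-pr = w₂ , ∈W w₂≢p w₂≢q w₂≢r , pr
    by-qr : ∃[ w ] (w ∈ W × Distinguishes Γ w q r)
    by-qr = w₃ , ∈W w₃≢p w₃≢q w₃≢r , qr

    swap : ∀ {u v} → ∃[ w ] (w ∈ W × Distinguishes Γ w u v) → ∃[ w ] (w ∈ W × Distinguishes Γ w v u)
    swap (w , w∈W , d) = w , w∈W , Distinguishes-sym Γ d

    W-resolving : WeaklyResolving Γ W
    W-resolving u v u≢v with locate u | locate v
    ... | inj₂ (inj₂ (inj₂ u∈W)) | _ = u , u∈W , distinguishes-self Γ sc u≢v
    ... | _ | inj₂ (inj₂ (inj₂ v∈W)) = v , v∈W , Distinguishes-sym Γ (distinguishes-self Γ sc (≢-sym u≢v))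
    ... | inj₁ refl               | inj₁ refl               = ⊥-elim (u≢v refl)
    ... | inj₂ (inj₁ refl)        | inj₂ (inj₁ refl)        = ⊥-elim (u≢v refl)
    ... | inj₂ (inj₂ (inj₁ refl)) | inj₂ (inj₂ (inj₁ refl)) = ⊥-elim (u≢v refl)
    ... | inj₁ refl               | inj₂ (inj₁ refl)        = by-pq
    ... | inj₁ refl               | inj₂ (inj₂ (inj₁ refl)) = by-pr
    ... | inj₂ (inj₁ refl)        | inj₂ (inj₂ (inj₁ refl)) = by-qr
    ... | inj₂ (inj₁ refl)        | inj₁ refl               = swap by-pq
    ... | inj₂ (inj₂ (inj₁ refl)) | inj₁ refl               = swap by-pr
    ... | inj₂ (inj₂ (inj₁ refl)) | inj₂ (inj₁ refl)        = swap by-qr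

module Twins {n : ℕ} (Γ : Digraph n) where

  infix 4 _∼_except_

  _∼_except_ : Fin n → Fin n → Fin n → Set
  u ∼ v except z = ∀ w → w ≢ u → w ≢ v → w ≢ z → Γ w u ≡ Γ w v × Γ u w ≡ Γ v w

  ∼-sym : ∀ {u v z} → u ∼ v except z → v ∼ u except z
  ∼-sym u∼v w w≢v w≢u w≢z = let (wu≡wv , uw≡vw) = u∼v w w≢u w≢v w≢z in sym wu≡wv , sym uw≡vw

  SeparatedAwayFrom : Fin n → Fin n → Fin n → Set
  SeparatedAwayFrom z u v = ∃[ w ] (w ≢ u × w ≢ v × w ≢ z × (Γ w u ≢ Γ w v ⊎ Γ u w ≢ Γ v w))

  twins-or-separated : ∀ u v z → u ∼ v except z ⊎ SeparatedAwayFrom z u v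
  twins-or-separated u v z
    with any? (λ w → ¬? (w ≟ u) ×-dec ¬? (w ≟ v) ×-dec ¬? (w ≟ z) ×-dec
                      (¬? (Γ w u Bool.≟ Γ w v) ⊎-dec ¬? (Γ u w Bool.≟ Γ v w)))
  ... | yes separated = inj₂ separated
  ... | no ¬separated = inj₁ λ w w≢u w≢v w≢z →
          decidable-stable (Γ w u Bool.≟ Γ w v) (λ ne → ¬separated (w , w≢u , w≢v , w≢z , inj₁ ne)) ,
          decidable-stable (Γ u w Bool.≟ Γ v w) (λ ne → ¬separated (w , w≢u , w≢v , w≢z , inj₂ ne))

module _ {n : ℕ} (Γ : Digraph n) (simple : Simple Γ) (sc : StronglyConnected Γ)
         (dim≥n∸2 : ∀ W → WeaklyResolving Γ W → n ∸ 2 ≤ ∣ W ∣) where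

  open Twins Γ

  twins-among-three : ∀ {u v z} → u ≢ v → u ≢ z → v ≢ z →
                      u ∼ v except z ⊎ u ∼ z except v ⊎ v ∼ z except u
  twins-among-three {u} {v} {z} u≢v u≢z v≢z
    with twins-or-separated u v z | twins-or-separated u z v | twins-or-separated v z u
  ... | inj₁ u∼v | _        | _        = inj₁ u∼v
  ... | _        | inj₁ u∼z | _        = inj₂ (inj₁ u∼z)
  ... | _        | _        | inj₁ v∼z = inj₂ (inj₂ v∼z)
  ... | inj₂ uv  | inj₂ uz  | inj₂ vz  =
    ⊥-elim (no-three-pairs-distinguished-away Γ sc dim≥n∸2 u≢v u≢z v≢z
              (distinguished uv) (distinguished uz) (distinguished vz))
    where
    distinguished : ∀ {z u v} → SeparatedAwayFrom z u v → DistinguishedAwayFrom Γ z u v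
    distinguished (w , w≢u , w≢v , w≢z , differ) = w , w≢u , w≢v , w≢z , distinguishes-by-arcs Γ simple sc differ

  two-step : ∀ {u v} → u ≢ v → Γ u v ≡ false → ∃[ w ] (Γ u w ≡ true × Γ w v ≡ true)
  two-step {u} {v} u≢v ¬uv with dist Γ sc u v
  ... | zero , uv = ⊥-elim (u≢v (Dist-0⇒≡ Γ uv))
  ... | suc zero , uv with trans (sym (arc≡[dist≡ᵇ1] Γ simple uv)) ¬uv
  ... | ()
  two-step u≢v ¬uv | suc (suc zero) , (cons uw (cons wv nil) , _) =
    _ , Equivalence.to T-≡ uw , Equivalence.to T-≡ wv
  two-step {u} u≢v ¬uv | suc (suc (suc _)) , uv@(cons {y = p} up (cons {y = q} pq (cons {y = r} qr rest)) , _) =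
    ⊥-elim (no-three-pairs-distinguished-away Γ sc dim≥n∸2
              (Dist-≢ Γ u-p u-q λ ()) (Dist-≢ Γ u-p u-r λ ()) (Dist-≢ Γ u-q u-r λ ())
              (by-u u-p u-q u-r λ ()) (by-u u-p u-r u-q λ ()) (by-u u-q u-r u-p λ ()))
    where
    u-p : Dist Γ u p 1
    u-p = Dist-prefix Γ uv (cons up nil) (cons pq (cons qr rest))
    u-q : Dist Γ u q 2
    u-q = Dist-prefix Γ uv (cons up (cons pq nil)) (cons qr rest)
    u-r : Dist Γ u r 3
    u-r = Dist-prefix Γ uv (cons up (cons pq (cons qr nil))) rest

    by-u : ∀ {x y z a b c} → Dist Γ u x (suc a) → Dist Γ u y (suc b) → Dist Γ u z (suc c) →
           suc a ≢ suc b → DistinguishedAwayFrom Γ z x y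
    by-u ux uy uz a≢b = u , u≢ ux , u≢ uy , u≢ uz , distinguishes-by-distance Γ sc ux uy a≢b
      where
      u≢ : ∀ {x a} → Dist Γ u x (suc a) → u ≢ x
      u≢ ux = Dist-≢ Γ (Dist-refl Γ u) ux λ ()

-- Classifications of Fin n and compositions of digraphs

Fibre : ∀ {A I : Set} → (A → I) → I → Set
Fibre {A} f i = Σ A λ x → f x ≡ i

fibres↔ : ∀ {A I : Set} (f : A → I) → A ↔ Σ I (Fibre f)
fibres↔ f = mk↔ₛ′ (λ x → f x , x , refl) (proj₁ ∘ proj₂) (λ { (_ , _ , refl) → refl }) (λ _ → refl)

Σ-Fin-zero↔ : ∀ {P : Fin 0 → Set} → Σ (Fin 0) P ↔ Fin 0
Σ-Fin-zero↔ = mk↔ₛ′ (λ { (() , _) }) (λ ()) (λ ()) (λ { (() , _) })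

Σ-Fin-suc↔ : ∀ {m} {P : Fin (suc m) → Set} → Σ (Fin (suc m)) P ↔ (P zero ⊎ Σ (Fin m) (P ∘ suc))
Σ-Fin-suc↔ = mk↔ₛ′ ∃-toSum [ ∃-here , ∃-there ]
  (λ { (inj₁ _) → refl ; (inj₂ _) → refl }) (λ { (zero , _) → refl ; (suc _ , _) → refl })

Σ-Fin↔Fin-sum : ∀ {m} (s : Fin m → ℕ) → Σ (Fin m) (Fin ∘ s) ↔ Fin (foldr _+_ 0 s)
Σ-Fin↔Fin-sum {zero}  s = Σ-Fin-zero↔
Σ-Fin↔Fin-sum {suc m} s = ↔-trans Σ-Fin-suc↔ (↔-trans (↔-refl ⊎-cong Σ-Fin↔Fin-sum (s ∘ suc)) (↔-sym +↔⊎))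

proposition↔Fin : ∀ {A : Set} → Dec A → Irrelevant A → ∃[ k ] (A ↔ Fin k)
proposition↔Fin (yes a) irr = 1 , mk↔ₛ′ (λ _ → zero) (λ _ → a) (λ { zero → refl }) (irr a)
proposition↔Fin (no ¬a) _   = 0 , mk↔ₛ′ (⊥-elim ∘ ¬a) (λ ()) (λ ()) (⊥-elim ∘ ¬a)

decidable-subset↔Fin : ∀ {n} {P : Fin n → Set} → Decidable P → (∀ {x} → Irrelevant (P x)) →
                       ∃[ k ] (Σ (Fin n) P ↔ Fin k)
decidable-subset↔Fin {zero}  P? irr = 0 , Σ-Fin-zero↔
decidable-subset↔Fin {suc n} P? irr with proposition↔Fin (P? zero) irr | decidable-subset↔Fin (P? ∘ suc) irr
... | j , here↔ | k , there↔ = j + k , ↔-trans Σ-Fin-suc↔ (↔-trans (here↔ ⊎-cong there↔) (↔-sym +↔⊎))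

module _ {n m : ℕ} (cls : Fin n → Fin m) (s : Fin m → ℕ) (fibre↔ : ∀ i → Fibre cls i ↔ Fin (s i)) where

  classes↔ : Fin n ↔ Σ (Fin m) (Fin ∘ s)
  classes↔ = ↔-trans (fibres↔ cls) (Σ-congˡ λ {i} → fibre↔ i)

  module _ {Γ : Digraph n} (G : Fin m → Fin m → Set) (simple : Simple Γ)
           (within : ∀ {x y} → x ≢ y → cls x ≡ cls y → Γ x y ≡ true)
           (across : ∀ {x y} → cls x ≢ cls y → Γ x y ≡ true ⇔ G (cls x) (cls y)) where

    open Inverse classes↔ using (to)
    open Injection (↔⇒↣ classes↔) using (injective)
    subst-loop : ∀ {i} (e : i ≡ i) (a : Fin (s i)) → subst (Fin ∘ s) e a ≡ a
    subst-loop e a = cong (λ e → subst (Fin ∘ s) e a) (Decidable⇒UIP.≡-irrelevant (_≟_ {m}) e refl)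

    arc⇒Comp : ∀ {x y} → Γ x y ≡ true → Comp G s (λ i → K (s i)) (to x) (to y)
    arc⇒Comp {x} {y} x→y with cls x ≟ cls y
    ... | yes same  = inj₁ (same , λ eq → arc⇒≢ simple x→y (injective (Σ-≡,≡→≡ (same , eq))))
    ... | no differ = inj₂ (differ , Equivalence.to (across differ) x→y)

    Comp⇒arc : ∀ {x y} → Comp G s (λ i → K (s i)) (to x) (to y) → Γ x y ≡ true
    Comp⇒arc (inj₁ (same , differ)) =
      within (λ { refl → differ (subst-loop same _) }) same
    Comp⇒arc (inj₂ (differ , g)) = Equivalence.from (across differ) g

    isomorphic-Comp : Isomorphic Γ (Comp G s (λ i → K (s i)))
    isomorphic-Comp = classes↔ , λ x y →
      mk⇔ (arc⇒Comp ∘ Equivalence.to T-≡) (Equivalence.from T-≡ ∘ Comp⇒arc)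

singleton-fibre↔ : ∀ {n m} {f : Fin n → Fin m} {i a} → f a ≡ i → (∀ {x} → f x ≡ i → x ≡ a) → Fibre f i ↔ Fin 1
singleton-fibre↔ {m = m} fa≡i unique = mk↔ₛ′ (λ _ → zero) (λ _ → _ , fa≡i) (λ { zero → refl })
  (λ { (x , fx≡i) → Σ-≡,≡→≡ (sym (unique fx≡i) , Decidable⇒UIP.≡-irrelevant (_≟_ {m}) _ _) })

inhabited⇒1≤ : ∀ {k} → Fin k → 1 ≤ k
inhabited⇒1≤ {suc _} _ = s≤s z≤n

distinct⇒2≤ : ∀ {k} {a b : Fin k} → a ≢ b → 2 ≤ k
distinct⇒2≤ {suc zero}    {zero} {zero} a≢b = ⊥-elim (a≢b refl)
distinct⇒2≤ {suc (suc _)} _                 = s≤s (s≤s z≤n)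

[1+m+n]∸m∸1≡n : ∀ m n → suc (m + n) ∸ m ∸ 1 ≡ n
[1+m+n]∸m∸1≡n zero    n = refl
[1+m+n]∸m∸1≡n (suc m) n = [1+m+n]∸m∸1≡n m n

m≤[1+m+n]∸3 : ∀ m {n} → 2 ≤ n → m ≤ suc (m + n) ∸ 3
m≤[1+m+n]∸3 m {suc zero}    (s≤s ())
m≤[1+m+n]∸3 m {suc (suc n)} _ rewrite +-suc m (suc n) | +-suc m n = m≤m+n m n

-- The structure of Γ

module Structure {n : ℕ} (Γ : Digraph n) (simple : Simple Γ) where

  open Twins Γ

  module _ (twins-among-three : ∀ {u v z} → u ≢ v → u ≢ z → v ≢ z →
                                u ∼ v except z ⊎ u ∼ z except v ⊎ v ∼ z except u)
           (two-step : ∀ {u v} → u ≢ v → Γ u v ≡ false → ∃[ w ] (Γ u w ≡ true × Γ w v ≡ true))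
           (x₀ : Fin n) where

    -- Given diameter two, X₂ is the set of vertices at distance 2 from x₀.
    X₁ X₂ : Fin n → Set
    X₁ x = Γ x₀ x ≡ true
    X₂ x = x ≢ x₀ × Γ x₀ x ≡ false

    cls : Fin n → Fin 3
    cls x with x ≟ x₀ | Γ x₀ x
    ... | yes _ | _     = 0F
    ... | no _  | true  = 1F
    ... | no _  | false = 2F

    data Class : Fin n → Fin 3 → Set where
      root : Class x₀ 0F
      out  : ∀ {x} → X₁ x → Class x 1F
      far  : ∀ {x} → X₂ x → Class x 2F

    class : ∀ x → Class x (cls x)
    class x with x ≟ x₀ | Γ x₀ x in x₀→x
    ... | yes refl | _     = root
    ... | no _     | true  = out x₀→x
    ... | no x≢x₀  | false = far (x≢x₀ , x₀→x)

    x₀≢X₁ : ∀ {b} → X₁ b → x₀ ≢ b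
    x₀≢X₁ = arc⇒≢ simple

    x₀≢X₂ : ∀ {c} → X₂ c → x₀ ≢ c
    x₀≢X₂ hc = ≢-sym (proj₁ hc)

    X₁≢X₂ : ∀ {b c} → X₁ b → X₂ c → b ≢ c
    X₁≢X₂ x₀→b (_ , x₀↛b) refl = clash x₀→b refl x₀↛b

    X₂≢X₁ : ∀ {c b} → X₂ c → X₁ b → c ≢ b
    X₂≢X₁ hc hb = ≢-sym (X₁≢X₂ hb hc)

    x₀-separates : ∀ {b c z} → X₁ b → X₂ c → z ≢ x₀ → ¬ (b ∼ c except z)
    x₀-separates hb hc z≢x₀ b∼c = clash hb (proj₁ (b∼c x₀ (x₀≢X₁ hb) (x₀≢X₂ hc) (≢-sym z≢x₀))) (proj₂ hc)

    X₂-twins : ∀ {b c c′} → X₁ b → X₂ c → X₂ c′ → c ≢ c′ → c ∼ c′ except b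
    X₂-twins hb hc hc′ c≢c′ with twins-among-three c≢c′ (X₂≢X₁ hc hb) (X₂≢X₁ hc′ hb)
    ... | inj₁ c∼c′         = c∼c′
    ... | inj₂ (inj₁ c∼b)  = ⊥-elim (x₀-separates hb hc (proj₁ hc′) (∼-sym c∼b))
    ... | inj₂ (inj₂ c′∼b) = ⊥-elim (x₀-separates hb hc′ (proj₁ hc) (∼-sym c′∼b))

    X₁-twins : ∀ {b b′ c} → X₁ b → X₁ b′ → b ≢ b′ → X₂ c → b ∼ b′ except c
    X₁-twins hb hb′ b≢b′ hc with twins-among-three b≢b′ (X₁≢X₂ hb hc) (X₁≢X₂ hb′ hc)
    ... | inj₁ b∼b′         = b∼b′
    ... | inj₂ (inj₁ b∼c)  = ⊥-elim (x₀-separates hb hc (≢-sym (x₀≢X₁ hb′)) b∼c)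
    ... | inj₂ (inj₂ b′∼c) = ⊥-elim (x₀-separates hb′ hc (≢-sym (x₀≢X₁ hb)) b′∼c)

    module _ (x₁ x₂ : Fin n) (x₁∈X₁ : X₁ x₁) (x₂∈X₂ : X₂ x₂) (x₂→x₀ : Γ x₂ x₀ ≡ true)
             (y y′ : Fin n) (y∈X₂ : X₂ y) (y′∈X₂ : X₂ y′) (y≢y′ : y ≢ y′) where

      another-X₂ : ∀ {c} → X₂ c → ∃[ c′ ] (X₂ c′ × c′ ≢ c)
      another-X₂ {c} hc with c ≟ y
      ... | yes refl = y′ , y′∈X₂ , ≢-sym y≢y′
      ... | no c≢y   = y , y∈X₂ , ≢-sym c≢y

      X₂→x₀ : ∀ {c} → X₂ c → Γ c x₀ ≡ true
      X₂→x₀ {c} hc with c ≟ x₂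
      ... | yes refl = x₂→x₀
      ... | no c≢x₂  = trans (proj₂ (X₂-twins x₁∈X₁ hc x₂∈X₂ c≢x₂ x₀ (x₀≢X₂ hc) (x₀≢X₂ x₂∈X₂) (x₀≢X₁ x₁∈X₁))) x₂→x₀

      X₁→x₀ : ∀ {b} → X₁ b → Γ b x₀ ≡ Γ x₁ x₀
      X₁→x₀ {b} hb with b ≟ x₁
      ... | yes refl = refl
      ... | no b≢x₁  = proj₂ (X₁-twins hb x₁∈X₁ b≢x₁ x₂∈X₂ x₀ (x₀≢X₁ hb) (x₀≢X₁ x₁∈X₁) (x₀≢X₂ x₂∈X₂))

      X₁→X₂-uniform : ∀ {b b′ c} → X₁ b → X₁ b′ → X₂ c → Γ b c ≡ Γ b′ c
      X₁→X₂-uniform {b} {b′} {c} hb hb′ hc with b ≟ b′ | another-X₂ hc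
      ... | yes refl | _               = refl
      ... | no b≢b′  | c′ , hc′ , c′≢c = proj₂ (X₁-twins hb hb′ b≢b′ hc′ c (X₂≢X₁ hc hb) (X₂≢X₁ hc hb′) (≢-sym c′≢c))

      X₁→X₂ : ∀ {b c} → X₁ b → X₂ c → Γ b c ≡ true
      X₁→X₂ hb hc with two-step (x₀≢X₂ hc) (proj₂ hc)
      ... | w , x₀→w , w→c = trans (X₁→X₂-uniform hb x₀→w hc) w→c

      one-way-or-twins : ∀ {b c c′} → X₁ b → X₂ c → X₂ c′ → c ≢ c′ →
                         (Γ c c′ ≡ false × Γ c′ c ≡ true) ⊎ b ∼ c except x₀
      one-way-or-twins {b} {c} {c′} hb hc hc′ c≢c′ with twins-among-three (x₀≢X₁ hb) (x₀≢X₂ hc) (X₁≢X₂ hb hc)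
      ... | inj₁ x₀∼b        =
        ⊥-elim (clash (X₁→X₂ hb hc′) (sym (proj₂ (x₀∼b c′ (proj₁ hc′) (X₂≢X₁ hc′ hb) (≢-sym c≢c′)))) (proj₂ hc′))
      ... | inj₂ (inj₁ x₀∼c) =
        let (c′→x₀≡c′→c , x₀→c′≡c→c′) = x₀∼c c′ (proj₁ hc′) (≢-sym c≢c′) (X₂≢X₁ hc′ hb)
        in inj₁ (trans (sym x₀→c′≡c→c′) (proj₂ hc′) , trans (sym c′→x₀≡c′→c) (X₂→x₀ hc′))
      ... | inj₂ (inj₂ b∼c)  = inj₂ b∼c

      no-X₁-detour : ∀ {c c′ w} → X₂ c → X₂ c′ → c ≢ c′ → Γ c c′ ≡ false →
                     X₁ w → Γ c w ≡ true → Γ w c′ ≡ true → ⊥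
      no-X₁-detour {c} {c′} {w} hc hc′ c≢c′ c↛c′ hw c→w w→c′ with one-way-or-twins hw hc hc′ c≢c′
      ... | inj₂ w∼c = clash w→c′ (proj₂ (w∼c c′ (X₂≢X₁ hc′ hw) (≢-sym c≢c′) (proj₁ hc′))) c↛c′
      ... | inj₁ (_ , c′→c) with one-way-or-twins hw hc′ hc (≢-sym c≢c′)
      ...   | inj₁ (c′↛c , _) = clash c′→c refl c′↛c
      ...   | inj₂ w∼c′       = clash c→w (proj₁ (w∼c′ c (X₂≢X₁ hc hw) c≢c′ (proj₁ hc))) c↛c′

      no-X₂-detour : ∀ {c c′ w} → X₂ c → X₂ c′ → c ≢ c′ → Γ c c′ ≡ false → X₂ w → Γ c w ≡ true → ⊥
      no-X₂-detour {c} {c′} {w} hc hc′ c≢c′ c↛c′ hw c→w with one-way-or-twins x₁∈X₁ hc hw (arc⇒≢ simple c→w)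
      ... | inj₁ (c↛w , _) = clash c→w refl c↛w
      ... | inj₂ x₁∼c      =
        clash (X₁→X₂ x₁∈X₁ hc′) (proj₂ (x₁∼c c′ (X₂≢X₁ hc′ x₁∈X₁) (≢-sym c≢c′) (proj₁ hc′))) c↛c′

      X₂→X₂ : ∀ {c c′} → X₂ c → X₂ c′ → c ≢ c′ → Γ c c′ ≡ true
      X₂→X₂ {c} {c′} hc hc′ c≢c′ with Γ c c′ in c→c′
      ... | true  = refl
      ... | false with two-step c≢c′ c→c′
      ...   | w , c→w , w→c′ with w ≟ x₀ | Γ x₀ w in x₀→w
      ...     | yes refl | _     = ⊥-elim (clash w→c′ refl (proj₂ hc′))
      ...     | no _     | true  = ⊥-elim (no-X₁-detour hc hc′ c≢c′ c→c′ x₀→w c→w w→c′)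
      ...     | no w≢x₀  | false = ⊥-elim (no-X₂-detour hc hc′ c≢c′ c→c′ (w≢x₀ , x₀→w) c→w)

      X₁-X₂-twins : ∀ {b c} → X₁ b → X₂ c → b ∼ c except x₀
      X₁-X₂-twins hb hc with another-X₂ hc
      ... | c′ , hc′ , c′≢c with one-way-or-twins hb hc hc′ (≢-sym c′≢c)
      ...   | inj₁ (c↛c′ , _) = ⊥-elim (clash (X₂→X₂ hc hc′ (≢-sym c′≢c)) refl c↛c′)
      ...   | inj₂ b∼c        = b∼c

      X₂→X₁ : ∀ {c b} → X₂ c → X₁ b → Γ c b ≡ true
      X₂→X₁ {c} hc hb with another-X₂ hc
      ... | c′ , hc′ , c′≢c =
        trans (proj₁ (X₁-X₂-twins hb hc′ c (X₂≢X₁ hc hb) (≢-sym c′≢c) (proj₁ hc))) (X₂→X₂ hc hc′ (≢-sym c′≢c))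

      X₁→X₁ : ∀ {b b′} → X₁ b → X₁ b′ → b ≢ b′ → Γ b b′ ≡ true
      X₁→X₁ hb hb′ b≢b′ =
        trans (proj₂ (X₁-X₂-twins hb x₂∈X₂ _ (≢-sym b≢b′) (X₁≢X₂ hb′ x₂∈X₂) (≢-sym (x₀≢X₁ hb′)))) (X₂→X₁ x₂∈X₂ hb′)

      within-class : ∀ {x y} → x ≢ y → cls x ≡ cls y → Γ x y ≡ true
      within-class {x} {y} x≢y same = arc (subst (Class x) same (class x)) (class y) x≢y
        where
        arc : ∀ {x y i} → Class x i → Class y i → x ≢ y → Γ x y ≡ true
        arc root     root     x≢y = ⊥-elim (x≢y refl)
        arc (out hx) (out hy) x≢y = X₁→X₁ hx hy x≢y
        arc (far hx) (far hy) x≢y = X₂→X₂ hx hy x≢y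

      arcs-between-classes : ∀ {G : Fin 3 → Fin 3 → Set} →
        G 0F 1F → ¬ G 0F 2F → G 1F 2F → G 2F 0F → G 2F 1F → (Γ x₁ x₀ ≡ true ⇔ G 1F 0F) →
        ∀ {x y i j} → Class x i → Class y j → i ≢ j → Γ x y ≡ true ⇔ G i j
      arcs-between-classes _   _    _   _   _   _   root     root     i≢j = ⊥-elim (i≢j refl)
      arcs-between-classes _   _    _   _   _   _   (out _)  (out _)  i≢j = ⊥-elim (i≢j refl)
      arcs-between-classes _   _    _   _   _   _   (far _)  (far _)  i≢j = ⊥-elim (i≢j refl)
      arcs-between-classes G01 _    _   _   _   _   root     (out hy) _   = mk⇔ (λ _ → G01) (λ _ → hy)
      arcs-between-classes _   ¬G02 _   _   _   _   root     (far hy) _   =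
        mk⇔ (λ x₀→y → ⊥-elim (clash x₀→y refl (proj₂ hy))) (⊥-elim ∘ ¬G02)
      arcs-between-classes _   _    _   _   _   G10 (out hx) root     _   =
        mk⇔ (Equivalence.to G10 ∘ trans (sym (X₁→x₀ hx))) (trans (X₁→x₀ hx) ∘ Equivalence.from G10)
      arcs-between-classes _   _    G12 _   _   _   (out hx) (far hy) _   = mk⇔ (λ _ → G12) (λ _ → X₁→X₂ hx hy)
      arcs-between-classes _   _    _   G20 _   _   (far hx) root     _   = mk⇔ (λ _ → G20) (λ _ → X₂→x₀ hx)
      arcs-between-classes _   _    _   _   G21 _   (far hx) (out hy) _   = mk⇔ (λ _ → G21) (λ _ → X₂→X₁ hx hy)

      class-unique : ∀ {x i j} → Class x i → Class x j → i ≡ j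
      class-unique root     root      = refl
      class-unique (out _)  (out _)   = refl
      class-unique (far _)  (far _)   = refl
      class-unique root     (out hx)  = ⊥-elim (x₀≢X₁ hx refl)
      class-unique root     (far hx)  = ⊥-elim (x₀≢X₂ hx refl)
      class-unique (out hx) root      = ⊥-elim (x₀≢X₁ hx refl)
      class-unique (far hx) root      = ⊥-elim (x₀≢X₂ hx refl)
      class-unique (out hx) (far hx′) = ⊥-elim (X₁≢X₂ hx hx′ refl)
      class-unique (far hx) (out hx′) = ⊥-elim (X₂≢X₁ hx hx′ refl)

      fibre-x₀↔ : Fibre cls 0F ↔ Fin 1
      fibre-x₀↔ = singleton-fibre↔ (class-unique (class x₀) root)
                    λ {x} cls-x≡0 → only-x₀ (subst (Class x) cls-x≡0 (class x))
        where
        only-x₀ : ∀ {x} → Class x 0F → x ≡ x₀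
        only-x₀ root = refl

      fibre-size : ∀ i → ∃[ k ] (Fibre cls i ↔ Fin k)
      fibre-size i = decidable-subset↔Fin (λ x → cls x ≟ i) (Decidable⇒UIP.≡-irrelevant _≟_)

      module Sizes {t k : ℕ} (X₁↔ : Fibre cls 1F ↔ Fin t) (X₂↔ : Fibre cls 2F ↔ Fin k) where

        fibre↔ : ∀ {c} → k ≡ c → ∀ i → Fibre cls i ↔ Fin (lookup (1 ∷ t ∷ c ∷ []) i)
        fibre↔ _    0F = fibre-x₀↔
        fibre↔ _    1F = X₁↔
        fibre↔ refl 2F = X₂↔

        n≡1+t+k : n ≡ suc (t + k)
        n≡1+t+k = begin
          n                  ≡⟨ ↔⇒≡ (↔-trans (classes↔ cls _ (fibre↔ refl)) (Σ-Fin↔Fin-sum _)) ⟩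
          1 + (t + (k + 0))  ≡⟨ cong (λ c → 1 + (t + c)) (+-identityʳ k) ⟩
          1 + (t + k)        ∎
          where open ≡-Reasoning

        1≤t : 1 ≤ t
        1≤t = inhabited⇒1≤ (Inverse.to X₁↔ (x₁ , class-unique (class x₁) (out x₁∈X₁)))

        2≤k : 2 ≤ k
        2≤k = distinct⇒2≤ {a = Inverse.to X₂↔ (y , class-unique (class y) (far y∈X₂))}
                          {b = Inverse.to X₂↔ (y′ , class-unique (class y′) (far y′∈X₂))}
                          λ eq → y≢y′ (cong proj₁ (Injection.injective (↔⇒↣ X₂↔) eq))

        t≤n∸3 : t ≤ n ∸ 3
        t≤n∸3 = subst (λ n → t ≤ n ∸ 3) (sym n≡1+t+k) (m≤[1+m+n]∸3 t 2≤k)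

        k≡n∸t∸1 : k ≡ n ∸ t ∸ 1
        k≡n∸t∸1 = trans (sym ([1+m+n]∸m∸1≡n t k)) (cong (λ n → n ∸ t ∸ 1) (sym n≡1+t+k))

        composition-with : ∀ {G} → G 0F 1F → ¬ G 0F 2F → G 1F 2F → G 2F 0F → G 2F 1F →
                           (Γ x₁ x₀ ≡ true ⇔ G 1F 0F) → Isomorphic Γ (Comp3K G n t)
        composition-with {G} G01 ¬G02 G12 G20 G21 G10 =
          isomorphic-Comp cls (sizes n t) (fibre↔ k≡n∸t∸1) G simple within-class λ differ →
            arcs-between-classes {G} G01 ¬G02 G12 G20 G21 G10 (class _) (class _) differ

        composition : Isomorphic Γ (Comp3K G₁ n t) ⊎ Isomorphic Γ (Comp3K G₂ n t)
        composition with Γ x₁ x₀ in x₁→x₀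
        ... | true  = inj₂ (composition-with {G₂} tt (λ ()) tt tt tt (mk⇔ (λ _ → tt) (λ _ → x₁→x₀)))
        ... | false = inj₁ (composition-with {G₁} tt (λ ()) tt tt tt
                        (mk⇔ (λ x₁→x₀′ → clash x₁→x₀′ refl x₁→x₀) λ ()))

      composition-structure :
        ∃[ t ] (1 ≤ t × t ≤ n ∸ 3 × (Isomorphic Γ (Comp3K G₁ n t) ⊎ Isomorphic Γ (Comp3K G₂ n t)))
      composition-structure with fibre-size 1F | fibre-size 2F
      ... | t , X₁↔ | k , X₂↔ = t , 1≤t , t≤n∸3 , composition
        where open Sizes X₁↔ X₂↔

proposition4p17 : (n : ℕ) (Γ : Digraph n) →
    Simple Γ → StronglyConnected Γ → 4 ≤ n → MetricDim Γ (n ∸ 2) →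
    (x₀ x₁ x₂ : Fin n) → T (Γ x₀ x₁) → T (Γ x₁ x₂) → T (Γ x₂ x₀) →
    Dist Γ x₀ x₂ 2 →
    (∃[ a ] ∃[ b ] (a ≢ b × Dist Γ x₀ a 2 × Dist Γ x₀ b 2)) →
    ∃[ t ] (1 ≤ t × t ≤ n ∸ 3 ×
      (Isomorphic Γ (Comp3K G₁ n t) ⊎ Isomorphic Γ (Comp3K G₂ n t)))
proposition4p17 n Γ simple sc _ (_ , dim≥n∸2) x₀ x₁ x₂ x₀→x₁ _ x₂→x₀ x₀-x₂ (y , y′ , y≢y′ , x₀-y , x₀-y′) =
  Structure.composition-structure Γ simple
    (twins-among-three Γ simple sc dim≥n∸2) (two-step Γ simple sc dim≥n∸2)
    x₀ x₁ x₂ (Equivalence.to T-≡ x₀→x₁) (at-distance-2 Γ simple x₀-x₂) (Equivalence.to T-≡ x₂→x₀)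
    y y′ (at-distance-2 Γ simple x₀-y) (at-distance-2 Γ simple x₀-y′) y≢y′
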